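{- Let $E$ be a finite set and $\mathcal{W} \subseteq \{+,-,0\}^E$. Then $\mathcal{W}$ is an affine oriented matroid if and only if $\mathcal{W}$ satisfies (A1) if $X,Y \in \mathcal{W}$ then $X \circ Y \in \mathcal{W}$ and $X \circ (-Y) \in \mathcal{W}$; (A2) if $X,Y \in \mathcal{W}$ with $\underline{X}=\underline{Y}$, then $I_e(X,Y) \cap \mathcal{W} \neq \emptyset$ for all $e \in S(X,Y)$; (A3) $\mathcal{P}(\mathcal{W}) \circ \mathcal{W} \subseteq \mathcal{W}$, i.e. $P \circ W \in \mathcal{W}$ for all $P \in \mathcal{P}(\mathcal{W})$, $W \in \mathcal{W}$.
   Context: A sign vector on a finite set $E$ is an element $X \in \{+,-,0\}^E$; its support is $\underline{X}=\{e : X_e \neq 0\}$, and $-X$ is obtained by swapping $+$ and $-$ in every coordinate. The composition is $(X\circ Y)_e = X_e$ if $X_e\neq 0$ and $Y_e$ otherwise. The separation set is $S(X,Y)=\{e: X_e,Y_e \neq 0,\ X_e \neq Y_e\}$. The sum $X+Y$ is defined by $(X+Y)_e = 0$ if $e \in S(X,Y)$ and $(X+Y)_e=(X\circ Y)_e$ otherwise. For $X \neq Y$ with $\underline{X}=\underline{Y}$ and $e\in S(X,Y)$: $I_e(X,Y)=\{V\in\{+,-,0\}^E : \underline{V}\subseteq \underline{X}-\{e\},\ V_f = X_f \text{ for all } f\notin S(X,Y)\}$, and $I(X,Y)=\bigcup_{e\in S(X,Y)} I_e(X,Y)$. For $\mathcal{W}\subseteq\{+,-,0\}^E$: $\mathrm{sym}(\mathcal{W})=\{V: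 V\in\mathcal{W},\ -V\in\mathcal{W}\}$, $\mathrm{asym}(\mathcal{W})=\mathcal{W}-\mathrm{sym}(\mathcal{W})$, and $\mathcal{P}(\mathcal{W})=\{X+(-Y) : X,Y\in\mathrm{asym}(\mathcal{W}),\ \underline{X}=\underline{Y},\ I(X,-Y)\cap\mathcal{W}=I(-X,Y)\cap\mathcal{W}=\emptyset\}$. A set $\mathcal{O}\subseteq\{+,-,0\}^{F}$ ($F$ finite) is (the covector set of) an oriented matroid if: (O1) the all-zero vector is in $\mathcal{O}$; (O2) $X\in\mathcal{O}\Rightarrow -X\in\mathcal{O}$; (O3) $X,Y\in\mathcal{O}\Rightarrow X\circ Y\in\mathcal{O}$; (O4) if $X,Y\in\mathcal{O}$ with $\underline{X}=\underline{Y}$ and $e\in S(X,Y)$, there is $Z\in\mathcal{O}$ with $Z_e=0$ and $Z_f=(X\circ Y)_f$ for all $f\notin S(X,Y)$. For $g\notin E$, $X\in\{+,-,0\}^E$ and $s\in\{+,-,0\}$, $[X,s]$ denotes the sign vector on $E\cup\{g\}$ that agrees with $X$ on $E$ and has value $s$ at $g$. A set $\mathcal{W}\subseteq\{+,-,0\}^E$ is an affine oriented matroid if there exist $g\notin E$ and an oriented matroid $\mathcal{O}$ on $E\cup\{g\}$ with $\mathcal{W}=\{X\in\{+,-,0\}^E : [X,+]\in\mathcal{O}\}$. -}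

module Defs where

open import Data.Nat using (ℕ; suc)
open import Data.Fin using (Fin)
open import Data.Bool using (Bool; true)
open import Data.Vec using (Vec; []; _∷_; lookup; map; zipWith; replicate)
open import Data.Product using (Σ; ∃; ∃-syntax; _×_; _,_)
open import Relation.Binary.PropositionalEquality using (_≡_; _≢_)
open import Relation.Nullary using (¬_)
open import Function.Bundles using (_⇔_)

data Sign : Set where
  ⊕ ⊖ 𝟘 : Sign

SignVec : ℕ → Set
SignVec n = Vec Sign n

negˢ : Sign → Sign
negˢ ⊕ = ⊖
negˢ ⊖ = ⊕
negˢ 𝟘 = 𝟘

neg : ∀ {n} → SignVec n → SignVec n
neg = map negˢ

compˢ : Sign → Sign → Sign
compˢ 𝟘 t = t
compˢ s t = s

_∘ˢ_ : ∀ {n} → SignVec n → SignVec n → SignVec n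
_∘ˢ_ = zipWith compˢ

sumˢ : Sign → Sign → Sign
sumˢ ⊕ ⊖ = 𝟘
sumˢ ⊖ ⊕ = 𝟘
sumˢ s t = compˢ s t

_+ˢ_ : ∀ {n} → SignVec n → SignVec n → SignVec n
_+ˢ_ = zipWith sumˢ

zeroVec : ∀ {n} → SignVec n
zeroVec = replicate _ 𝟘

InSupp : ∀ {n} → SignVec n → Fin n → Set
InSupp X e = lookup X e ≢ 𝟘

SameSupport : ∀ {n} → SignVec n → SignVec n → Set
SameSupport X Y = ∀ f → (lookup X f ≡ 𝟘 ⇔ lookup Y f ≡ 𝟘)

Sep : ∀ {n} → SignVec n → SignVec n → Fin n → Set
Sep X Y e = InSupp X e × InSupp Y e × lookup X e ≢ lookup Y e

InIe : ∀ {n} → SignVec n → SignVec n → Fin n → SignVec n → Set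
InIe X Y e V =
  (∀ f → InSupp V f → InSupp X f × f ≢ e) ×
  (∀ f → ¬ Sep X Y f → lookup V f ≡ lookup X f)

InI : ∀ {n} → SignVec n → SignVec n → SignVec n → Set
InI X Y V = ∃[ e ] (Sep X Y e × InIe X Y e V)

-- Subsets of {+,-,0}^E, given by (decidable) characteristic functions
SVSet : ℕ → Set
SVSet n = SignVec n → Bool

_∈ˢ_ : ∀ {n} → SignVec n → SVSet n → Set
X ∈ˢ W = W X ≡ true

InSym : ∀ {n} → SVSet n → SignVec n → Set
InSym W V = V ∈ˢ W × neg V ∈ˢ W

InAsym : ∀ {n} → SVSet n → SignVec n → Set
InAsym W V = V ∈ˢ W × ¬ InSym W V

InP : ∀ {n} → SVSet n → SignVec n → Set
InP W Z = ∃[ X ] ∃[ Y ]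
  (InAsym W X × InAsym W Y × SameSupport X Y ×
   (∀ V → InI X (neg Y) V → ¬ V ∈ˢ W) ×
   (∀ V → InI (neg X) Y V → ¬ V ∈ˢ W) ×
   Z ≡ X +ˢ neg Y)

IsOrientedMatroid : ∀ {m} → SVSet m → Set
IsOrientedMatroid O =
  (zeroVec ∈ˢ O) ×
  (∀ X → X ∈ˢ O → neg X ∈ˢ O) ×
  (∀ X Y → X ∈ˢ O → Y ∈ˢ O → (X ∘ˢ Y) ∈ˢ O) ×
  (∀ X Y → X ∈ˢ O → Y ∈ˢ O → SameSupport X Y → ∀ e → Sep X Y e →
     ∃[ Z ] (Z ∈ˢ O × lookup Z e ≡ 𝟘 ×
             (∀ f → ¬ Sep X Y f → lookup Z f ≡ lookup (X ∘ˢ Y) f)))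

-- [X, s]: the new element g is the first coordinate of Fin (suc n)
ext : ∀ {n} → SignVec n → Sign → SignVec (suc n)
ext X s = s ∷ X

IsAffineOM : ∀ {n} → SVSet n → Set
IsAffineOM {n} W =
  ∃[ O ] (IsOrientedMatroid {suc n} O × (∀ X → (X ∈ˢ W ⇔ ext X ⊕ ∈ˢ O)))

A1 : ∀ {n} → SVSet n → Set
A1 W = ∀ X Y → X ∈ˢ W → Y ∈ˢ W → (X ∘ˢ Y) ∈ˢ W × (X ∘ˢ neg Y) ∈ˢ W

A2 : ∀ {n} → SVSet n → Set
A2 W = ∀ X Y → X ∈ˢ W → Y ∈ˢ W → SameSupport X Y →
  ∀ e → Sep X Y e → ∃[ V ] (InIe X Y e V × V ∈ˢ W)

A3 : ∀ {n} → SVSet n → Set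
A3 W = ∀ P V → InP W P → V ∈ˢ W → (P ∘ˢ V) ∈ˢ W

-- Forward: with W = {X : [X,+] ∈ O}, A1 and A2 are composition and elimination in O. For A3,
-- eliminating [X,+] against -[Y,+] at the new coordinate yields some [U,0] ∈ O with U = X off
-- S(X,-Y); on S(X,-Y) a nonzero U_f could be cancelled against X or Y into an element of
-- I(X,-Y) ∩ W or I(-X,Y) ∩ W, so U = X + (-Y), and [U,0] ∘ [V,+] gives P ∘ V ∈ W.
--
-- Backward: O consists of [X,+] and [-X,-] for X ∈ W, and [U,0] for the U with U ∘ W ⊆ W and
-- (-U) ∘ W ⊆ W. Composition is A1. Eliminating [X,+] against -[Y,+] at the new coordinate needs
-- such a U agreeing with X off S(X,-Y); by descent on |S(X,-Y)|, either X or -Y is symmetric, or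
-- an element of I(X,-Y) ∩ W or I(-X,Y) ∩ W lets one shrink S(X,-Y), or X + (-Y) ∈ P(W) works by
-- A3. The remaining eliminations follow by applying A2 against such stable vectors, the one
-- between two [U,0], [U',0] after a second descent over some X ∈ W.
module Submission where

open import Defs
open import Data.Nat using (ℕ; zero; suc; _<_; _≤_; z≤n; s≤s)
open import Data.Nat.Properties using (m≤n⇒m≤1+n; <-≤-trans)
open import Data.Nat.Induction using (<-wellFounded; Acc; acc)
open import Data.Fin using (Fin; zero; suc) renaming (_≟_ to _≟ᶠ_)
open import Data.Fin.Properties using (all?; any?)
open import Data.Bool using (true)
open import Data.Bool.Properties using (T-≡) renaming (_≟_ to _≟ᵇ_)
open import Data.Vec using ([]; _∷_; lookup; _[_]≔_)
open import Data.Vec.Properties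
  using (lookup-map; lookup-zipWith; map-∘; map-cong; map-id; map-replicate; zipWith-assoc;
         zipWith-identityˡ; tabulate∘lookup; tabulate-cong; lookup∘updateAt; lookup∘updateAt′)
open import Data.Product using (∃-syntax; _×_; _,_; proj₁; proj₂; uncurry)
open import Data.Sum using (_⊎_; inj₁; inj₂; map₂)
open import Data.Empty using (⊥-elim)
open import Relation.Binary.PropositionalEquality
open import Relation.Binary.Definitions using (DecidableEquality)
open import Relation.Nullary using (Dec; yes; no; ¬_)
open import Relation.Nullary.Decidable using (_×-dec_; _→-dec_; ¬?; isYes; toWitness; fromWitness)
open import Function.Base using (_∘_; id)
open import Function.Bundles using (_⇔_; mk⇔; Equivalence)
open import Function.Properties.Equivalence using () renaming (refl to ⇔-refl; sym to ⇔-sym; trans to ⇔-trans)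
open import Data.Product.Function.NonDependent.Propositional using (_×-⇔_)
open Equivalence using (to; from)

_≟ˢ_ : DecidableEquality Sign
⊕ ≟ˢ ⊕ = yes refl
⊕ ≟ˢ ⊖ = no (λ ())
⊕ ≟ˢ 𝟘 = no (λ ())
⊖ ≟ˢ ⊕ = no (λ ())
⊖ ≟ˢ ⊖ = yes refl
⊖ ≟ˢ 𝟘 = no (λ ())
𝟘 ≟ˢ ⊕ = no (λ ())
𝟘 ≟ˢ ⊖ = no (λ ())
𝟘 ≟ˢ 𝟘 = yes refl

-- Sep X Y f is by definition Sepˢ (lookup X f) (lookup Y f).
Sepˢ : Sign → Sign → Set
Sepˢ x y = x ≢ 𝟘 × y ≢ 𝟘 × x ≢ y

sepˢ? : ∀ x y → Dec (Sepˢ x y)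
sepˢ? x y = ¬? (x ≟ˢ 𝟘) ×-dec ¬? (y ≟ˢ 𝟘) ×-dec ¬? (x ≟ˢ y)

negˢ-involutive : ∀ x → negˢ (negˢ x) ≡ x
negˢ-involutive ⊕ = refl
negˢ-involutive ⊖ = refl
negˢ-involutive 𝟘 = refl

negˢ-𝟘 : ∀ {x} → x ≡ 𝟘 → negˢ x ≡ 𝟘
negˢ-𝟘 refl = refl

negˢ-𝟘⁻¹ : ∀ {x} → negˢ x ≡ 𝟘 → x ≡ 𝟘
negˢ-𝟘⁻¹ {𝟘} _ = refl

compˢ-assoc : ∀ x y z → compˢ (compˢ x y) z ≡ compˢ x (compˢ y z)
compˢ-assoc ⊕ y z = refl
compˢ-assoc ⊖ y z = refl
compˢ-assoc 𝟘 y z = refl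

compˢ-idem : ∀ x → compˢ x x ≡ x
compˢ-idem ⊕ = refl
compˢ-idem ⊖ = refl
compˢ-idem 𝟘 = refl

compˢ-identityʳ : ∀ x → compˢ x 𝟘 ≡ x
compˢ-identityʳ ⊕ = refl
compˢ-identityʳ ⊖ = refl
compˢ-identityʳ 𝟘 = refl

compˢ-⊒ : ∀ {x y} → (x ≡ 𝟘 → y ≡ 𝟘) → compˢ x y ≡ x
compˢ-⊒ {⊕} _ = refl
compˢ-⊒ {⊖} _ = refl
compˢ-⊒ {𝟘} y≡𝟘 = y≡𝟘 refl

compˢ-absorb : ∀ x y → compˢ x (compˢ y x) ≡ compˢ x y
compˢ-absorb ⊕ y = refl
compˢ-absorb ⊖ y = refl
compˢ-absorb 𝟘 y = compˢ-identityʳ y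

negˢ-compˢ : ∀ x y → negˢ (compˢ x y) ≡ compˢ (negˢ x) (negˢ y)
negˢ-compˢ ⊕ y = refl
negˢ-compˢ ⊖ y = refl
negˢ-compˢ 𝟘 y = refl

compˢ-≢𝟘 : ∀ {x} y → x ≢ 𝟘 → compˢ x y ≡ x
compˢ-≢𝟘 {⊕} y _ = refl
compˢ-≢𝟘 {⊖} y _ = refl
compˢ-≢𝟘 {𝟘} y x≢𝟘 = ⊥-elim (x≢𝟘 refl)

negˢ-sumˢ : ∀ x y → negˢ (sumˢ x (negˢ y)) ≡ sumˢ y (negˢ x)
negˢ-sumˢ ⊕ ⊕ = refl
negˢ-sumˢ ⊕ ⊖ = refl
negˢ-sumˢ ⊕ 𝟘 = refl
negˢ-sumˢ ⊖ ⊕ = refl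
negˢ-sumˢ ⊖ ⊖ = refl
negˢ-sumˢ ⊖ 𝟘 = refl
negˢ-sumˢ 𝟘 ⊕ = refl
negˢ-sumˢ 𝟘 ⊖ = refl
negˢ-sumˢ 𝟘 𝟘 = refl

sumˢ-¬sep : ∀ x y → ¬ Sepˢ x y → sumˢ x y ≡ compˢ x y
sumˢ-¬sep ⊕ ⊖ ¬s = ⊥-elim (¬s ((λ ()) , (λ ()) , (λ ())))
sumˢ-¬sep ⊖ ⊕ ¬s = ⊥-elim (¬s ((λ ()) , (λ ()) , (λ ())))
sumˢ-¬sep ⊕ ⊕ _ = refl
sumˢ-¬sep ⊕ 𝟘 _ = refl
sumˢ-¬sep ⊖ ⊖ _ = refl
sumˢ-¬sep ⊖ 𝟘 _ = refl
sumˢ-¬sep 𝟘 y _ = refl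

sumˢ-sep : ∀ x y → Sepˢ x y → sumˢ x y ≡ 𝟘
sumˢ-sep ⊕ ⊖ _ = refl
sumˢ-sep ⊖ ⊕ _ = refl
sumˢ-sep ⊕ ⊕ (_ , _ , x≢y) = ⊥-elim (x≢y refl)
sumˢ-sep ⊖ ⊖ (_ , _ , x≢y) = ⊥-elim (x≢y refl)
sumˢ-sep x 𝟘 (_ , y≢𝟘 , _) = ⊥-elim (y≢𝟘 refl)
sumˢ-sep 𝟘 y (x≢𝟘 , _ , _) = ⊥-elim (x≢𝟘 refl)

sepˢ-sym : ∀ {x y} → Sepˢ x y → Sepˢ y x
sepˢ-sym (x≢𝟘 , y≢𝟘 , x≢y) = y≢𝟘 , x≢𝟘 , (λ y≡x → x≢y (sym y≡x))

sepˢ-negˢ : ∀ {x} → x ≢ 𝟘 → Sepˢ x (negˢ x)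
sepˢ-negˢ {⊕} _ = (λ ()) , (λ ()) , (λ ())
sepˢ-negˢ {⊖} _ = (λ ()) , (λ ()) , (λ ())
sepˢ-negˢ {𝟘} x≢𝟘 = ⊥-elim (x≢𝟘 refl)

sepˢ-negˢ⁻¹ : ∀ {x y} → Sepˢ x (negˢ y) → x ≡ y
sepˢ-negˢ⁻¹ {⊕} {⊕} _ = refl
sepˢ-negˢ⁻¹ {⊖} {⊖} _ = refl
sepˢ-negˢ⁻¹ {⊕} {⊖} (_ , _ , x≢y) = ⊥-elim (x≢y refl)
sepˢ-negˢ⁻¹ {⊖} {⊕} (_ , _ , x≢y) = ⊥-elim (x≢y refl)
sepˢ-negˢ⁻¹ {x} {𝟘} (_ , y≢𝟘 , _) = ⊥-elim (y≢𝟘 refl)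
sepˢ-negˢ⁻¹ {𝟘} {y} (x≢𝟘 , _ , _) = ⊥-elim (x≢𝟘 refl)

sepˢ-negˢ-swap : ∀ {x y} → Sepˢ x (negˢ y) → Sepˢ y (negˢ x)
sepˢ-negˢ-swap s with sepˢ-negˢ⁻¹ s
... | refl = s

sepˢ-negˢ-both : ∀ {x y} → Sepˢ x y → Sepˢ (negˢ x) (negˢ y)
sepˢ-negˢ-both (x≢𝟘 , y≢𝟘 , x≢y) =
  (λ z → x≢𝟘 (negˢ-𝟘⁻¹ z)) , (λ z → y≢𝟘 (negˢ-𝟘⁻¹ z)) ,
  (λ eq → x≢y (trans (sym (negˢ-involutive _)) (trans (cong negˢ eq) (negˢ-involutive _))))

trichotomyˢ : ∀ u {x} → x ≢ 𝟘 → u ≡ 𝟘 ⊎ u ≡ x ⊎ u ≡ negˢ x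
trichotomyˢ 𝟘 _ = inj₁ refl
trichotomyˢ ⊕ {⊕} _ = inj₂ (inj₁ refl)
trichotomyˢ ⊕ {⊖} _ = inj₂ (inj₂ refl)
trichotomyˢ ⊖ {⊕} _ = inj₂ (inj₂ refl)
trichotomyˢ ⊖ {⊖} _ = inj₂ (inj₁ refl)
trichotomyˢ u {𝟘} x≢𝟘 = ⊥-elim (x≢𝟘 refl)

compˢ-𝟘 : ∀ {x y} → compˢ x y ≡ 𝟘 ⇔ (x ≡ 𝟘 × y ≡ 𝟘)
compˢ-𝟘 {⊕} = mk⇔ (λ ()) (λ ())
compˢ-𝟘 {⊖} = mk⇔ (λ ()) (λ ())
compˢ-𝟘 {𝟘} = mk⇔ (refl ,_) proj₂

negˢ-𝟘⇔ : ∀ {x} → negˢ x ≡ 𝟘 ⇔ x ≡ 𝟘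
negˢ-𝟘⇔ = mk⇔ negˢ-𝟘⁻¹ negˢ-𝟘

module _ {n : ℕ} where

  lookup-neg : ∀ (X : SignVec n) f → lookup (neg X) f ≡ negˢ (lookup X f)
  lookup-neg X f = lookup-map f negˢ X

  lookup-∘ : ∀ (X Y : SignVec n) f → lookup (X ∘ˢ Y) f ≡ compˢ (lookup X f) (lookup Y f)
  lookup-∘ X Y f = lookup-zipWith compˢ f X Y

  lookup-+ : ∀ (X Y : SignVec n) f → lookup (X +ˢ Y) f ≡ sumˢ (lookup X f) (lookup Y f)
  lookup-+ X Y f = lookup-zipWith sumˢ f X Y

  lookup-ext : ∀ {X Y : SignVec n} → (∀ f → lookup X f ≡ lookup Y f) → X ≡ Y
  lookup-ext {X} {Y} eq = trans (sym (tabulate∘lookup X)) (trans (tabulate-cong eq) (tabulate∘lookup Y))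

  neg-involutive : ∀ (X : SignVec n) → neg (neg X) ≡ X
  neg-involutive X = trans (sym (map-∘ negˢ negˢ X)) (trans (map-cong negˢ-involutive X) (map-id X))

  neg-zeroVec : neg (zeroVec {n}) ≡ zeroVec
  neg-zeroVec = map-replicate negˢ 𝟘 n

  zeroVec-∘ : ∀ (X : SignVec n) → zeroVec ∘ˢ X ≡ X
  zeroVec-∘ = zipWith-identityˡ (λ _ → refl)

  ∘-assoc : ∀ (X Y Z : SignVec n) → (X ∘ˢ Y) ∘ˢ Z ≡ X ∘ˢ (Y ∘ˢ Z)
  ∘-assoc = zipWith-assoc compˢ-assoc

neg-∘ : ∀ {n} (X Y : SignVec n) → neg (X ∘ˢ Y) ≡ neg X ∘ˢ neg Y
neg-∘ [] [] = refl
neg-∘ (x ∷ X) (y ∷ Y) = cong₂ _∷_ (negˢ-compˢ x y) (neg-∘ X Y)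

∘-absorb : ∀ {n} (X Y : SignVec n) → X ∘ˢ (Y ∘ˢ X) ≡ X ∘ˢ Y
∘-absorb [] [] = refl
∘-absorb (x ∷ X) (y ∷ Y) = cong₂ _∷_ (compˢ-absorb x y) (∘-absorb X Y)

neg-+-neg : ∀ {n} (X Y : SignVec n) → neg (X +ˢ neg Y) ≡ Y +ˢ neg X
neg-+-neg [] [] = refl
neg-+-neg (x ∷ X) (y ∷ Y) = cong₂ _∷_ (negˢ-sumˢ x y) (neg-+-neg X Y)

module _ {n : ℕ} where

  infix 4 _⊑_
  _⊑_ : SignVec n → SignVec n → Set
  V ⊑ X = ∀ f → lookup X f ≡ 𝟘 → lookup V f ≡ 𝟘

  zero-neg : ∀ (X : SignVec n) f → lookup (neg X) f ≡ 𝟘 ⇔ lookup X f ≡ 𝟘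
  zero-neg X f = subst (λ s → s ≡ 𝟘 ⇔ lookup X f ≡ 𝟘) (sym (lookup-neg X f)) negˢ-𝟘⇔

  zero-∘ : ∀ (X Y : SignVec n) f → lookup (X ∘ˢ Y) f ≡ 𝟘 ⇔ (lookup X f ≡ 𝟘 × lookup Y f ≡ 𝟘)
  zero-∘ X Y f =
    subst (λ s → s ≡ 𝟘 ⇔ (lookup X f ≡ 𝟘 × lookup Y f ≡ 𝟘)) (sym (lookup-∘ X Y f)) compˢ-𝟘

  sameSupport-sym : ∀ (X Y : SignVec n) → SameSupport X Y → SameSupport Y X
  sameSupport-sym X Y ss f = ⇔-sym (ss f)

  sameSupport-negʳ : ∀ (X Y : SignVec n) → SameSupport X Y → SameSupport X (neg Y)
  sameSupport-negʳ X Y ss f = ⇔-trans (ss f) (⇔-sym (zero-neg Y f))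

  sameSupport-negˡ : ∀ (X Y : SignVec n) → SameSupport X Y → SameSupport (neg X) Y
  sameSupport-negˡ X Y ss f = ⇔-trans (zero-neg X f) (ss f)

  sameSupport-neg : ∀ (X Y : SignVec n) → SameSupport X Y → SameSupport (neg X) (neg Y)
  sameSupport-neg X Y ss f = ⇔-trans (zero-neg X f) (sameSupport-negʳ X Y ss f)

  sameSupport-∘ʳ : ∀ (P P' X : SignVec n) → SameSupport P P' → SameSupport (P ∘ˢ X) (P' ∘ˢ X)
  sameSupport-∘ʳ P P' X ss f =
    ⇔-trans (zero-∘ P X f) (⇔-trans (ss f ×-⇔ ⇔-refl) (⇔-sym (zero-∘ P' X f)))

  sameSupport-∘-comm : ∀ (X Y : SignVec n) → SameSupport (X ∘ˢ Y) (Y ∘ˢ X)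
  sameSupport-∘-comm X Y f = mk⇔ (swap-zeros X Y) (swap-zeros Y X)
    where
      swap-zeros : ∀ A B → lookup (A ∘ˢ B) f ≡ 𝟘 → lookup (B ∘ˢ A) f ≡ 𝟘
      swap-zeros A B z = let (a , b) = to (zero-∘ A B f) z in from (zero-∘ B A f) (b , a)

  ⊑⇒sameSupport-∘ : ∀ (V X : SignVec n) → V ⊑ X → SameSupport X (V ∘ˢ X)
  ⊑⇒sameSupport-∘ V X V⊑X f =
    mk⇔ (λ x≡𝟘 → from (zero-∘ V X f) (V⊑X f x≡𝟘 , x≡𝟘)) (λ z → proj₂ (to (zero-∘ V X f) z))

  ¬Sep⇒≡ : ∀ (X Y : SignVec n) {f} → SameSupport X Y → ¬ Sep X Y f → lookup X f ≡ lookup Y f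
  ¬Sep⇒≡ X Y {f} ss ¬s with lookup X f ≟ˢ 𝟘 | lookup X f ≟ˢ lookup Y f
  ... | _        | yes x≡y = x≡y
  ... | yes x≡𝟘 | no _     = trans x≡𝟘 (sym (to (ss f) x≡𝟘))
  ... | no x≢𝟘  | no x≢y   = ⊥-elim (¬s (x≢𝟘 , (λ y≡𝟘 → x≢𝟘 (from (ss f) y≡𝟘)) , x≢y))

  ≡⇒¬Sep : ∀ (X Y : SignVec n) {f} → lookup X f ≡ lookup Y f → ¬ Sep X Y f
  ≡⇒¬Sep X Y x≡y (_ , _ , x≢y) = x≢y x≡y

  Sep-neg-swap : ∀ (X Y : SignVec n) {f} → Sep X (neg Y) f → Sep Y (neg X) f
  Sep-neg-swap X Y {f} s = subst (Sepˢ (lookup Y f)) (sym (lookup-neg X f))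
    (sepˢ-negˢ-swap (subst (Sepˢ (lookup X f)) (lookup-neg Y f) s))

  InIe⇒⊑ : ∀ (X Y V : SignVec n) {e} → InIe X Y e V → V ⊑ X
  InIe⇒⊑ X Y V (supp , _) f x≡𝟘 with lookup V f ≟ˢ 𝟘
  ... | yes v≡𝟘 = v≡𝟘
  ... | no v≢𝟘  = ⊥-elim (proj₁ (supp f v≢𝟘) x≡𝟘)

  InIe⇒𝟘 : ∀ (X Y V : SignVec n) {e} → InIe X Y e V → lookup V e ≡ 𝟘
  InIe⇒𝟘 X Y V {e} (supp , _) with lookup V e ≟ˢ 𝟘
  ... | yes v≡𝟘 = v≡𝟘
  ... | no v≢𝟘  = ⊥-elim (proj₂ (supp e v≢𝟘) refl)

  +-¬Sep : ∀ (X Y : SignVec n) {f} → SameSupport X Y → ¬ Sep X Y f → lookup (X +ˢ Y) f ≡ lookup X f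
  +-¬Sep X Y {f} ss ¬s =
    trans (lookup-+ X Y f) (trans (sumˢ-¬sep _ _ ¬s) (compˢ-⊒ (to (ss f))))

  +-Sep : ∀ (X Y : SignVec n) {f} → Sep X Y f → lookup (X +ˢ Y) f ≡ 𝟘
  +-Sep X Y {f} s = trans (lookup-+ X Y f) (sumˢ-sep _ _ s)

  ∘-sameSupport : ∀ (X Y : SignVec n) → SameSupport X Y → X ∘ˢ Y ≡ X
  ∘-sameSupport X Y ss = lookup-ext λ f → trans (lookup-∘ X Y f) (compˢ-⊒ (to (ss f)))

  Sep-neg⇒≡ : ∀ (X Y : SignVec n) {f} → Sep X (neg Y) f → lookup X f ≡ lookup Y f
  Sep-neg⇒≡ X Y {f} s = sepˢ-negˢ⁻¹ (subst (Sepˢ (lookup X f)) (lookup-neg Y f) s)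

  ¬Sep-neg⇒≡neg : ∀ (X Y : SignVec n) {f} → SameSupport X Y → ¬ Sep X (neg Y) f →
    lookup Y f ≡ negˢ (lookup X f)
  ¬Sep-neg⇒≡neg X Y {f} ss ¬s = begin
    lookup Y f                 ≡⟨ sym (negˢ-involutive _) ⟩
    negˢ (negˢ (lookup Y f))   ≡⟨ cong negˢ (sym (lookup-neg Y f)) ⟩
    negˢ (lookup (neg Y) f)    ≡⟨ cong negˢ (sym (¬Sep⇒≡ X (neg Y) (sameSupport-negʳ X Y ss) ¬s)) ⟩
    negˢ (lookup X f)          ∎
    where open ≡-Reasoning

  InIe-intro : ∀ (X Y V : SignVec n) {e} → SameSupport X Y → lookup V e ≡ 𝟘 →
    (∀ f → ¬ Sep X Y f → lookup V f ≡ lookup (X ∘ˢ Y) f) → InIe X Y e V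
  InIe-intro X Y V {e} ss v≡𝟘 agree = supp , agreeX
    where
      agreeX : ∀ f → ¬ Sep X Y f → lookup V f ≡ lookup X f
      agreeX f ¬s = trans (agree f ¬s) (cong (λ Z → lookup Z f) (∘-sameSupport X Y ss))
      supp : ∀ f → InSupp V f → InSupp X f × f ≢ e
      supp f v≢𝟘 = (λ x≡𝟘 → v≢𝟘 (trans (agreeX f (λ (x≢𝟘 , _) → x≢𝟘 x≡𝟘)) x≡𝟘)) ,
                   (λ { refl → v≢𝟘 v≡𝟘 })

  InIe-sym : ∀ (X Y V : SignVec n) {e} → SameSupport X Y → InIe X Y e V → InIe Y X e V
  InIe-sym X Y V ss (supp , agree) =
    (λ f v≢𝟘 → let (x≢𝟘 , f≢e) = supp f v≢𝟘 in (λ y≡𝟘 → x≢𝟘 (from (ss f) y≡𝟘)) , f≢e) ,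
    (λ f ¬s → trans (agree f (¬s ∘ sepˢ-sym)) (¬Sep⇒≡ X Y ss (¬s ∘ sepˢ-sym)))

  InI-sym : ∀ (X Y V : SignVec n) → SameSupport X Y → InI X Y V → InI Y X V
  InI-sym X Y V ss (e , s , ie) = e , sepˢ-sym s , InIe-sym X Y V ss ie

  InIe-∘-agree : ∀ (X U V : SignVec n) {e f} → InIe X (U ∘ˢ X) e V → lookup U f ≡ lookup X f →
    lookup V f ≡ lookup X f
  InIe-∘-agree X U V {f = f} (_ , agree) u≡x = agree f (≡⇒¬Sep X (U ∘ˢ X) (sym (begin
    lookup (U ∘ˢ X) f               ≡⟨ lookup-∘ U X f ⟩
    compˢ (lookup U f) (lookup X f) ≡⟨ cong (λ u → compˢ u (lookup X f)) u≡x ⟩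
    compˢ (lookup X f) (lookup X f) ≡⟨ compˢ-idem _ ⟩
    lookup X f                      ∎)))
    where open ≡-Reasoning

  Sep-neg : ∀ (X Y : SignVec n) {f} → Sep X Y f → Sep (neg X) (neg Y) f
  Sep-neg X Y {f} s = subst₂ Sepˢ (sym (lookup-neg X f)) (sym (lookup-neg Y f)) (sepˢ-negˢ-both s)

  lookup-∘-≢𝟘 : ∀ (P X : SignVec n) {f} → InSupp P f → lookup (P ∘ˢ X) f ≡ lookup P f
  lookup-∘-≢𝟘 P X {f} p≢𝟘 = trans (lookup-∘ P X f) (compˢ-≢𝟘 _ p≢𝟘)

  Sep-∘ʳ : ∀ (P P' X : SignVec n) {f} → Sep P P' f → Sep (P ∘ˢ X) (P' ∘ˢ X) f
  Sep-∘ʳ P P' X s@(p≢𝟘 , p'≢𝟘 , _) =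
    subst₂ Sepˢ (sym (lookup-∘-≢𝟘 P X p≢𝟘)) (sym (lookup-∘-≢𝟘 P' X p'≢𝟘)) s

  InIe-∘ʳ-agree : ∀ (P P' X V : SignVec n) {e f} → InIe (P ∘ˢ X) (P' ∘ˢ X) e V →
    InSupp P f → lookup P f ≡ lookup P' f → lookup V f ≡ lookup P f
  InIe-∘ʳ-agree P P' X V {f = f} (_ , agree) p≢𝟘 p≡p' =
    trans (agree f (≡⇒¬Sep (P ∘ˢ X) (P' ∘ˢ X) px≡p'x)) (lookup-∘-≢𝟘 P X p≢𝟘)
    where
      px≡p'x : lookup (P ∘ˢ X) f ≡ lookup (P' ∘ˢ X) f
      px≡p'x = trans (lookup-∘-≢𝟘 P X p≢𝟘)
                     (trans p≡p' (sym (lookup-∘-≢𝟘 P' X (λ p'≡𝟘 → p≢𝟘 (trans p≡p' p'≡𝟘)))))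

InIe? : ∀ {n} (X Y : SignVec n) e V → Dec (InIe X Y e V)
InIe? X Y e V =
  all? (λ f → ¬? (lookup V f ≟ˢ 𝟘) →-dec (¬? (lookup X f ≟ˢ 𝟘) ×-dec ¬? (f ≟ᶠ e))) ×-dec
  all? (λ f → ¬? (sepˢ? (lookup X f) (lookup Y f)) →-dec (lookup V f ≟ˢ lookup X f))

InI? : ∀ {n} (X Y V : SignVec n) → Dec (InI X Y V)
InI? X Y V = any? λ e → sepˢ? (lookup X e) (lookup Y e) ×-dec InIe? X Y e V

allSignVec? : ∀ {n} {P : SignVec n → Set} → (∀ V → Dec (P V)) → Dec (∀ V → P V)
allSignVec? {zero} P? with P? []
... | yes p = yes λ { [] → p }
... | no ¬p = no λ all → ¬p (all [])
allSignVec? {suc n} P? with allSignVec? (P? ∘ (⊕ ∷_)) | allSignVec? (P? ∘ (⊖ ∷_)) | allSignVec? (P? ∘ (𝟘 ∷_))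
... | yes p⊕ | yes p⊖ | yes p𝟘 = yes λ { (⊕ ∷ V) → p⊕ V ; (⊖ ∷ V) → p⊖ V ; (𝟘 ∷ V) → p𝟘 V }
... | no ¬p⊕ | _      | _      = no λ all → ¬p⊕ (all ∘ (⊕ ∷_))
... | yes _  | no ¬p⊖ | _      = no λ all → ¬p⊖ (all ∘ (⊖ ∷_))
... | yes _  | yes _  | no ¬p𝟘 = no λ all → ¬p𝟘 (all ∘ (𝟘 ∷_))

anySignVec? : ∀ {n} {P : SignVec n → Set} → (∀ V → Dec (P V)) → Dec (∃[ V ] P V)
anySignVec? {zero} P? with P? []
... | yes p = yes ([] , p)
... | no ¬p = no λ { ([] , p) → ¬p p }
anySignVec? {suc n} P? with anySignVec? (P? ∘ (⊕ ∷_)) | anySignVec? (P? ∘ (⊖ ∷_)) | anySignVec? (P? ∘ (𝟘 ∷_))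
... | yes (V , p) | _           | _           = yes (⊕ ∷ V , p)
... | no _        | yes (V , p) | _           = yes (⊖ ∷ V , p)
... | no _        | no _        | yes (V , p) = yes (𝟘 ∷ V , p)
... | no ¬p⊕      | no ¬p⊖      | no ¬p𝟘      =
  no λ { (⊕ ∷ V , p) → ¬p⊕ (V , p) ; (⊖ ∷ V , p) → ¬p⊖ (V , p) ; (𝟘 ∷ V , p) → ¬p𝟘 (V , p) }

count : ∀ {n} {P : Fin n → Set} → (∀ i → Dec (P i)) → ℕ
count {zero}  P? = 0
count {suc n} P? with P? zero
... | yes _ = suc (count (P? ∘ suc))
... | no _  = count (P? ∘ suc)

count-mono : ∀ {n} {P Q : Fin n → Set} (P? : ∀ i → Dec (P i)) (Q? : ∀ i → Dec (Q i)) →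
  (∀ i → P i → Q i) → count P? ≤ count Q?
count-mono {zero} P? Q? P⇒Q = z≤n
count-mono {suc n} P? Q? P⇒Q with P? zero | Q? zero
... | yes _ | yes _  = s≤s (count-mono (P? ∘ suc) (Q? ∘ suc) (P⇒Q ∘ suc))
... | yes p | no ¬q  = ⊥-elim (¬q (P⇒Q zero p))
... | no _  | yes _  = m≤n⇒m≤1+n (count-mono (P? ∘ suc) (Q? ∘ suc) (P⇒Q ∘ suc))
... | no _  | no _   = count-mono (P? ∘ suc) (Q? ∘ suc) (P⇒Q ∘ suc)

count-< : ∀ {n} {P Q : Fin n → Set} (P? : ∀ i → Dec (P i)) (Q? : ∀ i → Dec (Q i)) →
  (∀ i → P i → Q i) → ∀ j → Q j → ¬ P j → count P? < count Q?
count-< {suc n} P? Q? P⇒Q zero qj ¬pj with P? zero | Q? zero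
... | yes p | _     = ⊥-elim (¬pj p)
... | no _  | no ¬q = ⊥-elim (¬q qj)
... | no _  | yes _ = s≤s (count-mono (P? ∘ suc) (Q? ∘ suc) (P⇒Q ∘ suc))
count-< {suc n} P? Q? P⇒Q (suc j) qj ¬pj with P? zero | Q? zero
... | yes _ | yes _  = s≤s (count-< (P? ∘ suc) (Q? ∘ suc) (P⇒Q ∘ suc) j qj ¬pj)
... | yes p | no ¬q  = ⊥-elim (¬q (P⇒Q zero p))
... | no _  | yes _  = m≤n⇒m≤1+n (count-< (P? ∘ suc) (Q? ∘ suc) (P⇒Q ∘ suc) j qj ¬pj)
... | no _  | no _   = count-< (P? ∘ suc) (Q? ∘ suc) (P⇒Q ∘ suc) j qj ¬pj

descent : ∀ {A : Set} (m : A → ℕ) {P R : A → Set} →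
  (∀ x → P x → R x ⊎ ∃[ y ] (P y × m y < m x × (R y → R x))) → ∀ x → P x → R x
descent {A} m {P} {R} step x = go x (<-wellFounded (m x))
  where
    go : ∀ x → Acc _<_ (m x) → P x → R x
    go x (acc rs) px with step x px
    ... | inj₁ r = r
    ... | inj₂ (y , py , y<x , R⇒) = R⇒ (go y (rs y<x) py)

opposite-elimination : ∀ {n} {W : SVSet n} → A2 W → ∀ {X U : SignVec n} {e} →
  X ∈ˢ W → (U ∘ˢ X) ∈ˢ W → U ⊑ X → InSupp X e → lookup U e ≡ negˢ (lookup X e) →
  ∃[ V ] (V ∈ˢ W × InIe X (U ∘ˢ X) e V)
opposite-elimination a2 {X} {U} {e} wX wUX U⊑X x≢𝟘 u≡-x
  with a2 X (U ∘ˢ X) wX wUX (⊑⇒sameSupport-∘ U X U⊑X) e separated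
  where
    separated : Sep X (U ∘ˢ X) e
    separated = subst (Sepˢ (lookup X e))
      (sym (trans (lookup-∘ U X e) (trans (cong (λ u → compˢ u (lookup X e)) u≡-x)
                                          (compˢ-⊒ (⊥-elim ∘ x≢𝟘 ∘ negˢ-𝟘⁻¹)))))
      (sepˢ-negˢ x≢𝟘)
... | V , ie , wV = V , wV , ie

module FromAffine {n} (W : SVSet n) (O : SVSet (suc n)) (O-om : IsOrientedMatroid O)
                  (W⇔O : ∀ X → (X ∈ˢ W ⇔ ext X ⊕ ∈ˢ O)) where

  private
    O2 = proj₁ (proj₂ O-om)
    O3 = proj₁ (proj₂ (proj₂ O-om))
    O4 = proj₂ (proj₂ (proj₂ O-om))

    toO : ∀ {X} → X ∈ˢ W → (⊕ ∷ X) ∈ˢ O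
    toO {X} = to (W⇔O X)

    fromO : ∀ {X} → (⊕ ∷ X) ∈ˢ O → X ∈ˢ W
    fromO {X} = from (W⇔O X)

  a1 : A1 W
  a1 X Y wX wY = fromO (O3 _ _ (toO wX) (toO wY)) , fromO (O3 _ _ (toO wX) (O2 _ (toO wY)))

  a2 : A2 W
  a2 X Y wX wY ss e s with O4 (⊕ ∷ X) (⊕ ∷ Y) (toO wX) (toO wY) ss⁺ (suc e) s
    where
      ss⁺ : SameSupport (⊕ ∷ X) (⊕ ∷ Y)
      ss⁺ zero    = ⇔-refl
      ss⁺ (suc f) = ss f
  ... | z ∷ V , zV∈O , v≡𝟘 , agree with agree zero (λ (_ , _ , ⊕≢⊕) → ⊕≢⊕ refl)
  ... | refl = V , InIe-intro X Y V ss v≡𝟘 (agree ∘ suc) , fromO zV∈O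

  ∘-closed : ∀ {U X} → (𝟘 ∷ U) ∈ˢ O → X ∈ˢ W → (U ∘ˢ X) ∈ˢ W
  ∘-closed U∈O wX = fromO (O3 _ _ U∈O (toO wX))

  -- If U_f = -X_f, cancelling f between X and U ∘ X gives an element of I_f(X,-Y) ∩ W.
  opposite-excluded : ∀ X Y U → X ∈ˢ W → (∀ V → InI X (neg Y) V → ¬ V ∈ˢ W) →
    (𝟘 ∷ U) ∈ˢ O → (∀ f → ¬ Sep X (neg Y) f → lookup U f ≡ lookup X f) →
    ∀ f → Sep X (neg Y) f → lookup U f ≢ negˢ (lookup X f)
  opposite-excluded X Y U wX noI U∈O agree f s u≡-x
    with opposite-elimination a2 wX (∘-closed U∈O wX) U⊑X (proj₁ s) u≡-x
    where
      U⊑X : U ⊑ X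
      U⊑X h x≡𝟘 = trans (agree h (λ (x≢𝟘 , _) → x≢𝟘 x≡𝟘)) x≡𝟘
  ... | V , wV , ie = noI V (f , s , proj₁ ie , λ h ¬s → InIe-∘-agree X U V ie (agree h ¬s)) wV

  a3 : A3 W
  a3 P V (X , Y , (wX , _) , (wY , _) , ss , noI , noI′ , refl) wV
    with O4 (⊕ ∷ X) (⊖ ∷ neg Y) (toO wX) (O2 _ (toO wY)) ss± zero ((λ ()) , (λ ()) , (λ ()))
    where
      ss± : SameSupport (⊕ ∷ X) (⊖ ∷ neg Y)
      ss± zero    = mk⇔ (λ ()) (λ ())
      ss± (suc f) = sameSupport-negʳ X Y ss f
  ... | z ∷ U , zU∈O , refl , agree = subst (λ P → (P ∘ˢ V) ∈ˢ W) U≡X+-Y (∘-closed zU∈O wV)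
    where
      agreeX : ∀ f → ¬ Sep X (neg Y) f → lookup U f ≡ lookup X f
      agreeX f ¬s = trans (agree (suc f) ¬s)
        (cong (λ Z → lookup Z f) (∘-sameSupport X (neg Y) (sameSupport-negʳ X Y ss)))

      agreeY : ∀ f → ¬ Sep Y (neg X) f → lookup (neg U) f ≡ lookup Y f
      agreeY f ¬s = trans (lookup-neg U f) (trans (cong negˢ (agreeX f ¬s′)) (sym (¬Sep-neg⇒≡neg X Y ss ¬s′)))
        where ¬s′ = ¬s ∘ Sep-neg-swap X Y

      noI″ : ∀ V → InI Y (neg X) V → ¬ V ∈ˢ W
      noI″ V i = noI′ V (InI-sym Y (neg X) V (sameSupport-negʳ Y X (sameSupport-sym X Y ss)) i)

      pointwise : ∀ f → lookup U f ≡ lookup (X +ˢ neg Y) f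
      pointwise f with sepˢ? (lookup X f) (lookup (neg Y) f)
      ... | no ¬s = trans (agreeX f ¬s) (sym (+-¬Sep X (neg Y) (sameSupport-negʳ X Y ss) ¬s))
      ... | yes s with trichotomyˢ (lookup U f) (proj₁ s)
      ...   | inj₁ u≡𝟘 = trans u≡𝟘 (sym (+-Sep X (neg Y) s))
      ...   | inj₂ (inj₂ u≡-x) = ⊥-elim (opposite-excluded X Y U wX noI zU∈O agreeX f s u≡-x)
      ...   | inj₂ (inj₁ u≡x) = ⊥-elim (opposite-excluded Y X (neg U) wY noI″ (O2 _ zU∈O) agreeY f
                                   (Sep-neg-swap X Y s)
                                   (trans (lookup-neg U f) (cong negˢ (trans u≡x (Sep-neg⇒≡ X Y s)))))

      U≡X+-Y : U ≡ X +ˢ neg Y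
      U≡X+-Y = lookup-ext pointwise

Eliminant : ∀ {m} → SVSet m → SignVec m → SignVec m → Fin m → Set
Eliminant O X Y e =
  ∃[ Z ] (Z ∈ˢ O × lookup Z e ≡ 𝟘 × (∀ f → ¬ Sep X Y f → lookup Z f ≡ lookup (X ∘ˢ Y) f))

module ToAffine {n} (W : SVSet n) (a1 : A1 W) (a2 : A2 W) (a3 : A3 W) where

  W? : ∀ V → Dec (V ∈ˢ W)
  W? V = W V ≟ᵇ true

  Stable : SignVec n → Set
  Stable U = ∀ X → X ∈ˢ W → (U ∘ˢ X) ∈ˢ W × (neg U ∘ˢ X) ∈ˢ W

  stable? : ∀ U → Dec (Stable U)
  stable? U = allSignVec? λ X → W? X →-dec (W? (U ∘ˢ X) ×-dec W? (neg U ∘ˢ X))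

  O : SVSet (suc n)
  O (⊕ ∷ X) = W X
  O (⊖ ∷ X) = W (neg X)
  O (𝟘 ∷ U) = isYes (stable? U)

  stable⇒∈O : ∀ {U} → Stable U → (𝟘 ∷ U) ∈ˢ O
  stable⇒∈O st = to T-≡ (fromWitness st)

  ∈O⇒stable : ∀ {U} → (𝟘 ∷ U) ∈ˢ O → Stable U
  ∈O⇒stable U∈O = toWitness (from T-≡ U∈O)

  stable-neg : ∀ {U} → Stable U → Stable (neg U)
  stable-neg {U} st X wX = proj₂ (st X wX) , subst (λ V → (V ∘ˢ X) ∈ˢ W) (sym (neg-involutive U)) (proj₁ (st X wX))

  stable-∘ : ∀ {U U'} → Stable U → Stable U' → Stable (U ∘ˢ U')
  stable-∘ {U} {U'} st st' X wX =
    subst (_∈ˢ W) (sym (∘-assoc U U' X)) (proj₁ (st _ (proj₁ (st' X wX)))) ,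
    subst (_∈ˢ W) (trans (sym (∘-assoc (neg U) (neg U') X)) (cong (_∘ˢ X) (sym (neg-∘ U U'))))
      (proj₂ (st _ (proj₂ (st' X wX))))

  symmetric⇒stable : ∀ {X} → X ∈ˢ W → neg X ∈ˢ W → Stable X
  symmetric⇒stable {X} wX w-X Z wZ = proj₁ (a1 X Z wX wZ) , proj₁ (a1 (neg X) Z w-X wZ)

  P⇒stable : ∀ {P} → InP W P → Stable P
  P⇒stable {P} p@(X , Y , asX , asY , ss , noI , noI′ , P≡) Z wZ = a3 P Z p wZ , a3 (neg P) Z p⁻ wZ
    where
      p⁻ : InP W (neg P)
      p⁻ = Y , X , asY , asX , sameSupport-sym X Y ss ,
           (λ V i → noI′ V (InI-sym Y (neg X) V (sameSupport-negʳ Y X (sameSupport-sym X Y ss)) i)) ,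
           (λ V i → noI V (InI-sym (neg Y) X V (sameSupport-sym X (neg Y) (sameSupport-negʳ X Y ss)) i)) ,
           trans (cong neg P≡) (neg-+-neg X Y)

  -- What eliminating [X,+] against -[Y,+] at the new coordinate has to produce.
  Cancellation : SignVec n → SignVec n → Set
  Cancellation X Y = ∃[ Q ] (Stable Q × Q ⊑ X × (∀ f → ¬ Sep X (neg Y) f → lookup Q f ≡ lookup X f))

  cancellation-swap : ∀ X Y → SameSupport X Y → Cancellation Y X → Cancellation X Y
  cancellation-swap X Y ss (Q , stQ , Q⊑Y , agree) =
    neg Q , stable-neg stQ ,
    (λ f x≡𝟘 → from (zero-neg Q f) (Q⊑Y f (to (ss f) x≡𝟘))) ,
    (λ f ¬s → let ¬s′ = ¬s ∘ Sep-neg-swap Y X in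
      trans (lookup-neg Q f) (trans (cong negˢ (agree f ¬s′))
        (sym (¬Sep-neg⇒≡neg Y X (sameSupport-sym X Y ss) ¬s′))))

  Sep-neg? : ∀ (X Y : SignVec n) f → Dec (Sep X (neg Y) f)
  Sep-neg? X Y f = sepˢ? (lookup X f) (lookup (neg Y) f)

  agreements : SignVec n → SignVec n → ℕ
  agreements X Y = count (Sep-neg? X Y)

  module Shrink (X Y V : SignVec n) (wY : Y ∈ˢ W) (ss : SameSupport X Y) (wV : V ∈ˢ W)
                {e} (s : Sep X (neg Y) e) (ie : InIe X (neg Y) e V) where

    X′ : SignVec n
    X′ = V ∘ˢ neg Y

    X′∈W : X′ ∈ˢ W
    X′∈W = proj₂ (a1 V Y wV wY)

    X′-agrees : ∀ f → ¬ Sep X (neg Y) f → lookup X′ f ≡ lookup X f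
    X′-agrees f ¬s = trans (lookup-∘ V (neg Y) f)
      (trans (cong (λ v → compˢ v (lookup (neg Y) f)) (proj₂ ie f ¬s))
             (compˢ-⊒ (to (sameSupport-negʳ X Y ss f))))

    sameSupport-X′ : SameSupport X′ Y
    sameSupport-X′ f = mk⇔
      (λ x′≡𝟘 → to (zero-neg Y f) (proj₂ (to (zero-∘ V (neg Y) f) x′≡𝟘)))
      (λ y≡𝟘 → from (zero-∘ V (neg Y) f)
                  (InIe⇒⊑ X (neg Y) V ie f (from (ss f) y≡𝟘) , from (zero-neg Y f) y≡𝟘))

    S-X′⊆S-X : ∀ f → Sep X′ (neg Y) f → Sep X (neg Y) f
    S-X′⊆S-X f s′ with sepˢ? (lookup X f) (lookup (neg Y) f)
    ... | yes s = s
    ... | no ¬s = subst (λ x → Sepˢ x (lookup (neg Y) f)) (X′-agrees f ¬s) s′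

    agreements-< : agreements X′ Y < agreements X Y
    agreements-< = count-< (Sep-neg? X′ Y) (Sep-neg? X Y) S-X′⊆S-X e s (≡⇒¬Sep X′ (neg Y) X′≡-Y)
      where
        X′≡-Y : lookup X′ e ≡ lookup (neg Y) e
        X′≡-Y = trans (lookup-∘ V (neg Y) e) (cong (λ v → compˢ v (lookup (neg Y) e)) (InIe⇒𝟘 X (neg Y) V ie))

    transfer : Cancellation X′ Y → Cancellation X Y
    transfer (Q , stQ , Q⊑X′ , agree) =
      Q , stQ , (λ f x≡𝟘 → Q⊑X′ f (from (sameSupport-X′ f) (to (ss f) x≡𝟘))) ,
      (λ f ¬s → trans (agree f (¬s ∘ S-X′⊆S-X f)) (X′-agrees f ¬s))

  Admissible : SignVec n × SignVec n → Set
  Admissible (X , Y) = X ∈ˢ W × Y ∈ˢ W × SameSupport X Y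

  cancellation-step : ∀ p → Admissible p →
    uncurry Cancellation p ⊎
    ∃[ p′ ] (Admissible p′ × uncurry agreements p′ < uncurry agreements p ×
             (uncurry Cancellation p′ → uncurry Cancellation p))
  cancellation-step (X , Y) (wX , wY , ss) with W? (neg X)
  ... | yes w-X = inj₁ (X , symmetric⇒stable wX w-X , (λ _ x≡𝟘 → x≡𝟘) , λ _ _ → refl)
  ... | no ¬w-X with W? (neg Y)
  ... | yes w-Y = inj₁ (neg Y , symmetric⇒stable w-Y (subst (_∈ˢ W) (sym (neg-involutive Y)) wY) ,
                        (λ f → to (ss-Y f)) , λ f ¬s → sym (¬Sep⇒≡ X (neg Y) ss-Y ¬s))
    where ss-Y = sameSupport-negʳ X Y ss
  ... | no ¬w-Y with anySignVec? (λ V → InI? X (neg Y) V ×-dec W? V)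
  ... | yes (V , (e , s , ie) , wV) = inj₂ ((X′ , Y) , (X′∈W , wY , sameSupport-X′) , agreements-< , transfer)
    where open Shrink X Y V wY ss wV s ie
  ... | no noI with anySignVec? (λ V → InI? Y (neg X) V ×-dec W? V)
  ... | yes (V , (e , s , ie) , wV) =
    inj₂ ((X′ , X) , (X′∈W , wX , sameSupport-X′) ,
          <-≤-trans agreements-< (count-mono (Sep-neg? Y X) (Sep-neg? X Y) (λ f → Sep-neg-swap Y X)) ,
          cancellation-swap X Y ss ∘ transfer)
    where open Shrink Y X V wX (sameSupport-sym X Y ss) wV s ie
  ... | no noI′ = inj₁ (X +ˢ neg Y , P⇒stable X+-Y∈P , +⊑ , λ f ¬s → +-¬Sep X (neg Y) ss-Y ¬s)
    where
      ss-Y = sameSupport-negʳ X Y ss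
      X+-Y∈P : InP W (X +ˢ neg Y)
      X+-Y∈P = X , Y , (wX , ¬w-X ∘ proj₂) , (wY , ¬w-Y ∘ proj₂) , ss ,
               (λ V i wV → noI (V , i , wV)) ,
               (λ V i wV → noI′ (V , InI-sym (neg X) Y V (sameSupport-negˡ X Y ss) i , wV)) ,
               refl
      +⊑ : (X +ˢ neg Y) ⊑ X
      +⊑ f x≡𝟘 = trans (+-¬Sep X (neg Y) ss-Y (λ (x≢𝟘 , _) → x≢𝟘 x≡𝟘)) x≡𝟘

  cancellation : ∀ {X Y} → X ∈ˢ W → Y ∈ˢ W → SameSupport X Y → Cancellation X Y
  cancellation {X} {Y} wX wY ss = descent (uncurry agreements) cancellation-step (X , Y) (wX , wY , ss)

  cancel-opposite : ∀ {X Q e} → X ∈ˢ W → Stable Q → Q ⊑ X → InSupp X e → lookup Q e ≡ negˢ (lookup X e) →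
    ∃[ V ] (V ∈ˢ W × lookup V e ≡ 𝟘 × (∀ f → lookup Q f ≡ lookup X f → lookup V f ≡ lookup X f))
  cancel-opposite {X} {Q} wX stQ Q⊑X x≢𝟘 q≡-x
    with opposite-elimination a2 wX (proj₁ (stQ X wX)) Q⊑X x≢𝟘 q≡-x
  ... | V , wV , ie = V , wV , InIe⇒𝟘 X (Q ∘ˢ X) V ie , λ f → InIe-∘-agree X Q V ie

  eliminant⊕⊖ : ∀ {X Y} → X ∈ˢ W → Y ∈ˢ W → SameSupport X Y →
    ∀ e → Sep (⊕ ∷ X) (⊖ ∷ neg Y) e → Eliminant O (⊕ ∷ X) (⊖ ∷ neg Y) e
  eliminant⊕⊖ {X} {Y} wX wY ss with cancellation wX wY ss
  ... | Q , stQ , Q⊑X , agree = eliminant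
    where
      intro : ∀ {e} z Z → (z ∷ Z) ∈ˢ O → lookup (z ∷ Z) e ≡ 𝟘 →
        (∀ f → ¬ Sep X (neg Y) f → lookup Z f ≡ lookup X f) → Eliminant O (⊕ ∷ X) (⊖ ∷ neg Y) e
      intro z Z Z∈O z≡𝟘 agreeZ = z ∷ Z , Z∈O , z≡𝟘 , λ
        { zero ¬s → ⊥-elim (¬s ((λ ()) , (λ ()) , (λ ())))
        ; (suc f) ¬s → trans (agreeZ f ¬s) (cong (λ V → lookup V f)
            (sym (∘-sameSupport X (neg Y) (sameSupport-negʳ X Y ss)))) }

      eliminant : ∀ e → Sep (⊕ ∷ X) (⊖ ∷ neg Y) e → Eliminant O (⊕ ∷ X) (⊖ ∷ neg Y) e
      eliminant zero    _ = intro 𝟘 Q (stable⇒∈O stQ) refl agree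
      eliminant (suc e) s with trichotomyˢ (lookup Q e) (proj₁ s)
      ... | inj₁ q≡𝟘 = intro 𝟘 Q (stable⇒∈O stQ) q≡𝟘 agree
      ... | inj₂ (inj₂ q≡-x) with cancel-opposite wX stQ Q⊑X (proj₁ s) q≡-x
      ...   | V , wV , v≡𝟘 , agreeV = intro ⊕ V wV v≡𝟘 λ f ¬s → agreeV f (agree f ¬s)
      eliminant (suc e) s | inj₂ (inj₁ q≡x) with cancel-opposite wY (stable-neg stQ) -Q⊑Y y≢𝟘 -q≡-y
        where
          x≡y = Sep-neg⇒≡ X Y s
          y≢𝟘 = λ y≡𝟘 → proj₁ s (trans x≡y y≡𝟘)
          -Q⊑Y : neg Q ⊑ Y
          -Q⊑Y f y≡𝟘 = from (zero-neg Q f) (Q⊑X f (from (ss f) y≡𝟘))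
          -q≡-y : lookup (neg Q) e ≡ negˢ (lookup Y e)
          -q≡-y = trans (lookup-neg Q e) (cong negˢ (trans q≡x x≡y))
      ...   | V , wV , v≡𝟘 , agreeV =
        intro ⊖ (neg V) (subst (_∈ˢ W) (sym (neg-involutive V)) wV) (trans (lookup-neg V e) (negˢ-𝟘 v≡𝟘)) agree-V
        where
          agree-V : ∀ f → ¬ Sep X (neg Y) f → lookup (neg V) f ≡ lookup X f
          agree-V f ¬s = begin
            lookup (neg V) f         ≡⟨ lookup-neg V f ⟩
            negˢ (lookup V f)        ≡⟨ cong negˢ (agreeV f -q≡y) ⟩
            negˢ (lookup Y f)        ≡⟨ cong negˢ y≡-x ⟩
            negˢ (negˢ (lookup X f)) ≡⟨ negˢ-involutive _ ⟩
            lookup X f               ∎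
            where
              open ≡-Reasoning
              y≡-x = ¬Sep-neg⇒≡neg X Y ss ¬s
              -q≡y = trans (lookup-neg Q f) (trans (cong negˢ (agree f ¬s)) (sym y≡-x))

  module AtInfinity {U U'} (stU : Stable U) (stU' : Stable U') (ss : SameSupport U U') {e} (s : Sep U U' e) where

    StableEliminant : Set
    StableEliminant =
      ∃[ Q ] (Stable Q × lookup Q e ≡ 𝟘 × (∀ f → ¬ Sep U U' f → lookup Q f ≡ lookup (U ∘ˢ U') f))

    U∘U'≡U : ∀ f → lookup (U ∘ˢ U') f ≡ lookup U f
    U∘U'≡U f = cong (λ V → lookup V f) (∘-sameSupport U U' ss)

    Excess? : ∀ X f → Dec (lookup U f ≡ 𝟘 × InSupp X f)
    Excess? X f = (lookup U f ≟ˢ 𝟘) ×-dec ¬? (lookup X f ≟ˢ 𝟘)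

    excess : SignVec n → ℕ
    excess X = count (Excess? X)

    reduce : ∀ {X Q h} → X ∈ˢ W → Stable Q →
      (∀ f → lookup U f ≡ 𝟘 → lookup X f ≡ 𝟘 → lookup Q f ≡ 𝟘) →
      lookup U h ≡ 𝟘 → InSupp X h → lookup Q h ≡ negˢ (lookup X h) →
      ∃[ X′ ] (X′ ∈ˢ W × excess X′ < excess X)
    reduce {X} {Q} {h} wX stQ Q-supp u≡𝟘 x≢𝟘 q≡-x
      with opposite-elimination a2 {X ∘ˢ Q} {Q} {h} wXQ wQXQ Q⊑XQ
             (x≢𝟘 ∘ trans (sym xq≡x)) (trans q≡-x (cong negˢ (sym xq≡x)))
      where
        wQX : (Q ∘ˢ X) ∈ˢ W
        wQX = proj₁ (stQ X wX)
        wXQ : (X ∘ˢ Q) ∈ˢ W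
        wXQ = subst (_∈ˢ W) (∘-absorb X Q) (proj₁ (a1 X (Q ∘ˢ X) wX wQX))
        wQXQ : (Q ∘ˢ (X ∘ˢ Q)) ∈ˢ W
        wQXQ = subst (_∈ˢ W) (sym (∘-absorb Q X)) wQX
        Q⊑XQ : Q ⊑ X ∘ˢ Q
        Q⊑XQ f xq≡𝟘 = proj₂ (to (zero-∘ X Q f) xq≡𝟘)
        xq≡x : lookup (X ∘ˢ Q) h ≡ lookup X h
        xq≡x = lookup-∘-≢𝟘 X Q x≢𝟘
    ... | X′ , wX′ , ie = X′ , wX′ ,
      count-< (Excess? X′) (Excess? X) shrinks h (u≡𝟘 , x≢𝟘)
              (λ (_ , x′≢𝟘) → x′≢𝟘 (InIe⇒𝟘 (X ∘ˢ Q) (Q ∘ˢ (X ∘ˢ Q)) X′ ie))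
      where
        shrinks : ∀ f → lookup U f ≡ 𝟘 × InSupp X′ f → lookup U f ≡ 𝟘 × InSupp X f
        shrinks f (u≡𝟘 , x′≢𝟘) = u≡𝟘 , λ x≡𝟘 →
          x′≢𝟘 (InIe⇒⊑ (X ∘ˢ Q) (Q ∘ˢ (X ∘ˢ Q)) X′ ie f
                       (from (zero-∘ X Q f) (x≡𝟘 , Q-supp f u≡𝟘 x≡𝟘)))

    -- V and V' cancel e in U ∘ X and in -U ∘ X; the cancellation Q of V ∘ V' against V' ∘ V
    -- can only be wrong on supp X ∖ supp U, and `reduce` shrinks that set.
    candidate : ∀ {X} → X ∈ˢ W → ∃[ Q ] (Stable Q × lookup Q e ≡ 𝟘 ×
      (∀ f → lookup U f ≡ 𝟘 → lookup X f ≡ 𝟘 → lookup Q f ≡ 𝟘) ×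
      (∀ f → ¬ Sep U U' f → InSupp U f → lookup Q f ≡ lookup U f))
    candidate {X} wX
      with a2 (U ∘ˢ X) (U' ∘ˢ X) (proj₁ (stU X wX)) (proj₁ (stU' X wX))
              (sameSupport-∘ʳ U U' X ss) e (Sep-∘ʳ U U' X s)
         | a2 (neg U ∘ˢ X) (neg U' ∘ˢ X) (proj₂ (stU X wX)) (proj₂ (stU' X wX))
              (sameSupport-∘ʳ (neg U) (neg U') X (sameSupport-neg U U' ss)) e
              (Sep-∘ʳ (neg U) (neg U') X (Sep-neg U U' s))
    ... | V , ie , wV | V' , ie' , wV'
      with cancellation (proj₁ (a1 V V' wV wV')) (proj₁ (a1 V' V wV' wV)) (sameSupport-∘-comm V V')
    ... | Q , stQ , Q⊑VV' , agree = Q , stQ , Q⊑VV' e (from (zero-∘ V V' e) (v≡𝟘 , v'≡𝟘)) , Q-supp , Q-agree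
      where
        v≡𝟘 = InIe⇒𝟘 (U ∘ˢ X) (U' ∘ˢ X) V ie
        v'≡𝟘 = InIe⇒𝟘 (neg U ∘ˢ X) (neg U' ∘ˢ X) V' ie'

        Q-supp : ∀ f → lookup U f ≡ 𝟘 → lookup X f ≡ 𝟘 → lookup Q f ≡ 𝟘
        Q-supp f u≡𝟘 x≡𝟘 = Q⊑VV' f (from (zero-∘ V V' f)
          ( InIe⇒⊑ (U ∘ˢ X) (U' ∘ˢ X) V ie f (from (zero-∘ U X f) (u≡𝟘 , x≡𝟘))
          , InIe⇒⊑ (neg U ∘ˢ X) (neg U' ∘ˢ X) V' ie' f
              (from (zero-∘ (neg U) X f) (from (zero-neg U f) u≡𝟘 , x≡𝟘))))

        Q-agree : ∀ f → ¬ Sep U U' f → InSupp U f → lookup Q f ≡ lookup U f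
        Q-agree f ¬s u≢𝟘 = trans (agree f (≡⇒¬Sep (V ∘ˢ V') (neg (V' ∘ˢ V)) vv'≡-v'v)) vv'≡u
          where
            u≡u' = ¬Sep⇒≡ U U' ss ¬s
            -u≢𝟘 = u≢𝟘 ∘ to (zero-neg U f)
            v≡u : lookup V f ≡ lookup U f
            v≡u = InIe-∘ʳ-agree U U' X V ie u≢𝟘 u≡u'
            v'≡-u : lookup V' f ≡ negˢ (lookup U f)
            v'≡-u = trans (InIe-∘ʳ-agree (neg U) (neg U') X V' ie' -u≢𝟘
                             (trans (lookup-neg U f) (trans (cong negˢ u≡u') (sym (lookup-neg U' f)))))
                          (lookup-neg U f)
            v'≢𝟘 : InSupp V' f
            v'≢𝟘 = u≢𝟘 ∘ negˢ-𝟘⁻¹ ∘ trans (sym v'≡-u)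
            vv'≡u : lookup (V ∘ˢ V') f ≡ lookup U f
            vv'≡u = trans (lookup-∘-≢𝟘 V V' (u≢𝟘 ∘ trans (sym v≡u))) v≡u
            vv'≡-v'v : lookup (V ∘ˢ V') f ≡ lookup (neg (V' ∘ˢ V)) f
            vv'≡-v'v = begin
              lookup (V ∘ˢ V') f              ≡⟨ vv'≡u ⟩
              lookup U f                      ≡⟨ sym (negˢ-involutive _) ⟩
              negˢ (negˢ (lookup U f))        ≡⟨ cong negˢ (sym v'≡-u) ⟩
              negˢ (lookup V' f)              ≡⟨ cong negˢ (sym (lookup-∘-≢𝟘 V' V v'≢𝟘)) ⟩
              negˢ (lookup (V' ∘ˢ V) f)       ≡⟨ sym (lookup-neg (V' ∘ˢ V) f) ⟩
              lookup (neg (V' ∘ˢ V)) f        ∎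
              where open ≡-Reasoning

    step : ∀ X → X ∈ˢ W → StableEliminant ⊎ ∃[ X′ ] (X′ ∈ˢ W × excess X′ < excess X)
    step X wX with candidate wX
    ... | Q , stQ , q≡𝟘 , Q-supp , Q-agree with any? (λ h → (lookup U h ≟ˢ 𝟘) ×-dec ¬? (lookup Q h ≟ˢ 𝟘))
    ... | no none = inj₁ (Q , stQ , q≡𝟘 , λ f ¬s → trans (Q≡U f ¬s) (sym (U∘U'≡U f)))
      where
        Q≡U : ∀ f → ¬ Sep U U' f → lookup Q f ≡ lookup U f
        Q≡U f ¬s with lookup U f ≟ˢ 𝟘 | lookup Q f ≟ˢ 𝟘
        ... | no u≢𝟘  | _        = Q-agree f ¬s u≢𝟘
        ... | yes u≡𝟘 | yes q≡𝟘 = trans q≡𝟘 (sym u≡𝟘)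
        ... | yes u≡𝟘 | no q≢𝟘  = ⊥-elim (none (f , u≡𝟘 , q≢𝟘))
    ... | yes (h , u≡𝟘 , q≢𝟘) with lookup X h ≟ˢ 𝟘
    ...   | yes x≡𝟘 = ⊥-elim (q≢𝟘 (Q-supp h u≡𝟘 x≡𝟘))
    ...   | no x≢𝟘 with trichotomyˢ (lookup Q h) x≢𝟘
    ...     | inj₁ q≡𝟘 = ⊥-elim (q≢𝟘 q≡𝟘)
    ...     | inj₂ (inj₂ q≡-x) = inj₂ (reduce wX stQ Q-supp u≡𝟘 x≢𝟘 q≡-x)
    ...     | inj₂ (inj₁ q≡x) = inj₂ (reduce wX (stable-neg stQ)
                                  (λ f u≡𝟘 x≡𝟘 → from (zero-neg Q f) (Q-supp f u≡𝟘 x≡𝟘)) u≡𝟘 x≢𝟘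
                                  (trans (lookup-neg Q h) (cong negˢ q≡x)))

    stableEliminant : StableEliminant
    stableEliminant with anySignVec? W?
    ... | yes (X , wX) =
      descent excess (λ X wX → map₂ (λ (X′ , wX′ , lt) → X′ , wX′ , lt , id) (step X wX)) X wX
    ... | no W≡∅ = U [ e ]≔ 𝟘 , (λ X wX → ⊥-elim (W≡∅ (X , wX))) , lookup∘updateAt e U ,
                   λ f ¬s → trans (lookup∘updateAt′ f e (λ { refl → ¬s s }) U) (sym (U∘U'≡U f))

  O-neg : ∀ Z → Z ∈ˢ O → neg Z ∈ˢ O
  O-neg (⊕ ∷ X) wX = subst (_∈ˢ W) (sym (neg-involutive X)) wX
  O-neg (⊖ ∷ X) w-X = w-X
  O-neg (𝟘 ∷ U) U∈O = stable⇒∈O (stable-neg (∈O⇒stable U∈O))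

  O-∘ : ∀ Z Z' → Z ∈ˢ O → Z' ∈ˢ O → (Z ∘ˢ Z') ∈ˢ O
  O-∘ (⊕ ∷ X) (⊕ ∷ Y) wX wY = proj₁ (a1 X Y wX wY)
  O-∘ (⊕ ∷ X) (⊖ ∷ Y) wX w-Y = subst (λ V → (X ∘ˢ V) ∈ˢ W) (neg-involutive Y) (proj₂ (a1 X (neg Y) wX w-Y))
  O-∘ (⊕ ∷ X) (𝟘 ∷ U) wX U∈O =
    subst (_∈ˢ W) (∘-absorb X U) (proj₁ (a1 X (U ∘ˢ X) wX (proj₁ (∈O⇒stable U∈O X wX))))
  O-∘ (⊖ ∷ X) (⊕ ∷ Y) w-X wY = subst (_∈ˢ W) (sym (neg-∘ X Y)) (proj₂ (a1 (neg X) Y w-X wY))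
  O-∘ (⊖ ∷ X) (⊖ ∷ Y) w-X w-Y = subst (_∈ˢ W) (sym (neg-∘ X Y)) (proj₁ (a1 (neg X) (neg Y) w-X w-Y))
  O-∘ (⊖ ∷ X) (𝟘 ∷ U) w-X U∈O = subst (_∈ˢ W) (trans (∘-absorb (neg X) (neg U)) (sym (neg-∘ X U)))
    (proj₁ (a1 (neg X) (neg U ∘ˢ neg X) w-X (proj₂ (∈O⇒stable U∈O (neg X) w-X))))
  O-∘ (𝟘 ∷ U) (⊕ ∷ Y) U∈O wY = proj₁ (∈O⇒stable U∈O Y wY)
  O-∘ (𝟘 ∷ U) (⊖ ∷ Y) U∈O w-Y = subst (_∈ˢ W) (sym (neg-∘ U Y)) (proj₂ (∈O⇒stable U∈O (neg Y) w-Y))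
  O-∘ (𝟘 ∷ U) (𝟘 ∷ U') U∈O U'∈O = stable⇒∈O (stable-∘ (∈O⇒stable U∈O) (∈O⇒stable U'∈O))

  eliminant-neg : ∀ {X Y e} → Eliminant O (neg X) (neg Y) e → Eliminant O X Y e
  eliminant-neg {X} {Y} {e} (Z , Z∈O , z≡𝟘 , agree) =
    neg Z , O-neg Z Z∈O , trans (lookup-neg Z e) (negˢ-𝟘 z≡𝟘) , λ f ¬s → begin
      lookup (neg Z) f                      ≡⟨ lookup-neg Z f ⟩
      negˢ (lookup Z f)                     ≡⟨ cong negˢ (agree f (¬s ∘ Sep-neg⁻¹)) ⟩
      negˢ (lookup (neg X ∘ˢ neg Y) f)      ≡⟨ sym (lookup-neg (neg X ∘ˢ neg Y) f) ⟩
      lookup (neg (neg X ∘ˢ neg Y)) f       ≡⟨ cong (λ V → lookup (neg V) f) (sym (neg-∘ X Y)) ⟩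
      lookup (neg (neg (X ∘ˢ Y))) f         ≡⟨ cong (λ V → lookup V f) (neg-involutive (X ∘ˢ Y)) ⟩
      lookup (X ∘ˢ Y) f                     ∎
    where
      open ≡-Reasoning
      Sep-neg⁻¹ : ∀ {f} → Sep (neg X) (neg Y) f → Sep X Y f
      Sep-neg⁻¹ {f} s = subst₂ (λ A B → Sep A B f) (neg-involutive X) (neg-involutive Y)
                               (Sep-neg (neg X) (neg Y) s)

  eliminant⊕⊕ : ∀ {X Y} → X ∈ˢ W → Y ∈ˢ W → SameSupport X Y →
    ∀ e → Sep (⊕ ∷ X) (⊕ ∷ Y) e → Eliminant O (⊕ ∷ X) (⊕ ∷ Y) e
  eliminant⊕⊕ wX wY ss zero (_ , _ , ⊕≢⊕) = ⊥-elim (⊕≢⊕ refl)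
  eliminant⊕⊕ {X} {Y} wX wY ss (suc e) s with a2 X Y wX wY ss e s
  ... | V , ie , wV = ⊕ ∷ V , wV , InIe⇒𝟘 X Y V ie , λ
    { zero _ → refl
    ; (suc f) ¬s → trans (proj₂ ie f ¬s) (cong (λ Z → lookup Z f) (sym (∘-sameSupport X Y ss))) }

  O-om : IsOrientedMatroid O
  O-om = stable⇒∈O stable-zeroVec , O-neg , O-∘ , O-elim
    where
      stable-zeroVec : Stable zeroVec
      stable-zeroVec X wX = subst (_∈ˢ W) (sym (zeroVec-∘ X)) wX ,
                            subst (_∈ˢ W) (sym (trans (cong (_∘ˢ X) neg-zeroVec) (zeroVec-∘ X))) wX

      O-elim : ∀ Z Z' → Z ∈ˢ O → Z' ∈ˢ O → SameSupport Z Z' → ∀ e → Sep Z Z' e → Eliminant O Z Z' e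
      O-elim (⊕ ∷ X) (⊕ ∷ Y) wX wY ss = eliminant⊕⊕ wX wY (ss ∘ suc)
      O-elim (⊕ ∷ X) (⊖ ∷ Y) wX w-Y ss =
        subst (λ Y → ∀ e → Sep (⊕ ∷ X) (⊖ ∷ Y) e → Eliminant O (⊕ ∷ X) (⊖ ∷ Y) e) (neg-involutive Y)
              (eliminant⊕⊖ wX w-Y (sameSupport-negʳ X Y (ss ∘ suc)))
      O-elim (⊖ ∷ X) (⊕ ∷ Y) w-X wY ss e s =
        eliminant-neg {⊖ ∷ X} {⊕ ∷ Y} (eliminant⊕⊖ w-X wY (sameSupport-negˡ X Y (ss ∘ suc))
                                    e (Sep-neg (⊖ ∷ X) (⊕ ∷ Y) {e} s))
      O-elim (⊖ ∷ X) (⊖ ∷ Y) w-X w-Y ss e s =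
        eliminant-neg {⊖ ∷ X} {⊖ ∷ Y}
          (eliminant⊕⊕ w-X w-Y (sameSupport-neg X Y (ss ∘ suc)) e (Sep-neg (⊖ ∷ X) (⊖ ∷ Y) {e} s))
      O-elim (𝟘 ∷ U) (𝟘 ∷ U') U∈O U'∈O ss zero (𝟘≢𝟘 , _) = ⊥-elim (𝟘≢𝟘 refl)
      O-elim (𝟘 ∷ U) (𝟘 ∷ U') U∈O U'∈O ss (suc e) s
        with AtInfinity.stableEliminant (∈O⇒stable U∈O) (∈O⇒stable U'∈O) (ss ∘ suc) s
      ... | Q , stQ , q≡𝟘 , agree =
        𝟘 ∷ Q , stable⇒∈O stQ , q≡𝟘 , λ { zero _ → refl ; (suc f) ¬s → agree f ¬s }
      O-elim (⊕ ∷ _) (𝟘 ∷ _) _ _ ss with from (ss zero) refl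
      ... | ()
      O-elim (⊖ ∷ _) (𝟘 ∷ _) _ _ ss with from (ss zero) refl
      ... | ()
      O-elim (𝟘 ∷ _) (⊕ ∷ _) _ _ ss with to (ss zero) refl
      ... | ()
      O-elim (𝟘 ∷ _) (⊖ ∷ _) _ _ ss with to (ss zero) refl
      ... | ()

  affine : IsAffineOM W
  affine = O , O-om , λ X → ⇔-refl

theorem2p1 : (n : ℕ) (W : SVSet n) → IsAffineOM W ⇔ (A1 W × A2 W × A3 W)
theorem2p1 n W = mk⇔ (λ (O , O-om , W⇔O) → let open FromAffine W O O-om W⇔O in a1 , a2 , a3)
                     (λ (a1 , a2 , a3) → ToAffine.affine W a1 a2 a3)
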